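{- $S_4$ is $4$-Turán-good, i.e. for every sufficiently large $n$, $\mathrm{ex}(n,S_4,K_4)=\mathcal{N}(S_4,T_3(n))$.
   Context: $S_4$ is the star with $3$ leaves. $T_3(n)$ is the complete $3$-partite graph on $n$ vertices with parts of size $\lfloor n/3\rfloor$ or $\lceil n/3\rceil$. $\mathcal{N}(H,G)$ is the number of subgraphs of $G$ isomorphic to $H$; $\mathrm{ex}(n,H,F)$ is the maximum of $\mathcal{N}(H,G)$ over $F$-free $n$-vertex graphs $G$. A graph is $k$-Turán-good if it is $K_k$-Turán-good, i.e. $\mathrm{ex}(n,H,K_k)=\mathcal{N}(H,T_{k-1}(n))$ for all large $n$. -}

module Defs where

open import Data.Bool using (Bool; true; false; _∧_; not; T; if_then_else_)
open import Data.Nat using (ℕ; zero; suc; _%_; _≡ᵇ_)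
open import Data.Fin using (Fin; toℕ; _<?_)
open import Data.Fin.Properties using (_≟_)
open import Data.List using (List; map; concatMap; allFin)
open import Data.Nat.ListAction using (sum)
open import Data.Product using (∃; _×_)
open import Relation.Nullary using (¬_)
open import Relation.Nullary.Decidable using (⌊_⌋)
open import Relation.Binary.PropositionalEquality using (_≡_; refl; cong)

record SimpleGraph (n : ℕ) : Set where
  field
    adj   : Fin n → Fin n → Bool
    sym   : ∀ u v → adj u v ≡ adj v u
    loopless : ∀ v → adj v v ≡ false
open SimpleGraph public

_~[_]_ : ∀ {n} → Fin n → SimpleGraph n → Fin n → Set
u ~[ G ] v = T (adj G u v)

-- G contains no K₄: there are no four pairwise adjacent vertices
-- (pairwise adjacency forces them to be distinct, since G is loopless).
K4-free : ∀ {n} → SimpleGraph n → Set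
K4-free {n} G = ¬ (∃ λ (a : Fin n) → ∃ λ (b : Fin n) → ∃ λ (c : Fin n) → ∃ λ (d : Fin n) →
  (a ~[ G ] b) × (a ~[ G ] c) × (a ~[ G ] d) ×
  (b ~[ G ] c) × (b ~[ G ] d) × (c ~[ G ] d))

_≢ᵇ_ : ∀ {n} → Fin n → Fin n → Bool
u ≢ᵇ v = not ⌊ u ≟ v ⌋

_<ᵇ_ : ∀ {n} → Fin n → Fin n → Bool
u <ᵇ v = ⌊ u <? v ⌋

-- A subgraph of G isomorphic to S₄ (the star K_{1,3}) is determined by its
-- centre c and its 3-element leaf set {a,b,d} (listed with a < b < d),
-- where c ∉ {a,b,d} and c is adjacent in G to a, b and d.
isS4copy : ∀ {n} → SimpleGraph n → Fin n → Fin n → Fin n → Fin n → Bool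
isS4copy G c a b d =
  (a <ᵇ b) ∧ (b <ᵇ d) ∧ (c ≢ᵇ a) ∧ (c ≢ᵇ b) ∧ (c ≢ᵇ d) ∧
  adj G c a ∧ adj G c b ∧ adj G c d

numS4 : ∀ {n} → SimpleGraph n → ℕ
numS4 {n} G =
  sum (concatMap (λ c → concatMap (λ a → concatMap (λ b → map (λ d →
    if isS4copy G c a b d then 1 else 0)
    (allFin n)) (allFin n)) (allFin n)) (allFin n))

-- Turán graph T₃(n): vertex i lies in part (i mod 3); two vertices are
-- adjacent iff they lie in different parts.  Part sizes are ⌊n/3⌋ or ⌈n/3⌉.
T3-adj : ∀ {n} → Fin n → Fin n → Bool
T3-adj i j = not ((toℕ i % 3) ≡ᵇ (toℕ j % 3))

private
  ≡ᵇ-sym : ∀ m n → (m ≡ᵇ n) ≡ (n ≡ᵇ m)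
  ≡ᵇ-sym zero    zero    = refl
  ≡ᵇ-sym zero    (suc n) = refl
  ≡ᵇ-sym (suc m) zero    = refl
  ≡ᵇ-sym (suc m) (suc n) = ≡ᵇ-sym m n

  ≡ᵇ-refl : ∀ m → (m ≡ᵇ m) ≡ true
  ≡ᵇ-refl zero    = refl
  ≡ᵇ-refl (suc m) = ≡ᵇ-refl m

  not-true : ∀ {b} → b ≡ true → not b ≡ false
  not-true refl = refl

T3 : (n : ℕ) → SimpleGraph n
T3 n = record
  { adj      = T3-adj
  ; sym      = λ u v → cong not (≡ᵇ-sym (toℕ u % 3) (toℕ v % 3))
  ; loopless = λ v → not-true (≡ᵇ-refl (toℕ v % 3))
  }

-- The number of copies of S₄ in a graph is Σ_v C(deg v, 3).  In a K₄-free graph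
-- let x have maximum degree, A = N(x), and let y ∈ A have the most neighbours
-- inside A.  Colour V ∖ A, A ∖ N(y) and A ∩ N(y) with three colours: K₄-freeness
-- and the two maximality choices give every vertex degree at most its degree in
-- the complete tripartite graph on these colour classes (Erdős' degree
-- majorisation).  Hence the count is at most p·C(q+r,3) + q·C(p+r,3) + r·C(p+q,3)
-- for some p + q + r = n.  Moving a vertex from the largest to the smallest class
-- never decreases this quantity, so it is maximised at the balanced triple,
-- which is the triple of class sizes of T₃(n).
module Submission where

open import Defs hiding (sym)
open import Data.Bool using (Bool; true; false; _∧_; not; T; if_then_else_)
open import Data.Bool.Properties using (∧-zeroʳ; T-∧; T-≡; T-not-≡)
open import Data.Empty using (⊥; ⊥-elim)
open import Data.Fin using (Fin; zero; suc; toℕ; fromℕ<)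
import Data.Fin as Fin
open import Data.Fin.Properties using (pigeonhole; toℕ-fromℕ<)
open import Data.List using (List; _∷_; []; map; concatMap; tabulate; allFin)
open import Data.List.Extrema.Nat using (argmax; f[xs]≤f[argmax])
open import Data.List.Membership.Propositional.Properties using (∈-allFin)
import Data.List.Relation.Unary.All as All
open import Data.Nat hiding (_<ᵇ_)
open import Data.Nat.DivMod using (m%n<n; [m+n]%n≡m%n)
open import Data.Nat.Induction using (<-wellFounded)
import Data.Nat.ListAction as List
open import Data.Nat.ListAction.Properties using (sum-++)
open import Data.Nat.Properties
open import Algebra.Properties.Semiring.Sum +-*-semiring
  using (sum-syntax; sum-cong-≗; sum-replicate-zero; ∑-distrib-+; *-distribˡ-sum; *-distribʳ-sum)
open import Data.Nat.Tactic.RingSolver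
open import Data.Product using (∃; ∃₂; ∃-syntax; _×_; _,_; proj₁; proj₂)
open import Data.Sum using (inj₁; inj₂)
open import Data.Unit using (tt)
import Data.Vec as Vec
open import Function using (_∘_; id)
open import Function.Bundles using (Equivalence)
open import Induction.WellFounded using (Acc; acc)
open import Relation.Binary.PropositionalEquality
open import Relation.Nullary using (yes; no)
open import Relation.Nullary.Decidable using (⌊⌋-map′)

C₂ : ℕ → ℕ
C₂ zero    = 0
C₂ (suc m) = C₂ m + m

C₃ : ℕ → ℕ
C₃ zero    = 0
C₃ (suc m) = C₃ m + C₂ m

C₂-+ : ∀ m n → C₂ (m + n) ≡ C₂ m + m * n + C₂ n
C₂-+ zero    n = refl
C₂-+ (suc m) n rewrite C₂-+ m n with C₂ m | C₂ n
... | c₂m | c₂n = solve (m ∷ n ∷ c₂m ∷ c₂n ∷ [])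

C₃-+ : ∀ m n → C₃ (m + n) ≡ C₃ m + C₂ m * n + m * C₂ n + C₃ n
C₃-+ zero    n = refl
C₃-+ (suc m) n rewrite C₃-+ m n | C₂-+ m n with C₂ m | C₂ n | C₃ m | C₃ n
... | c₂m | c₂n | c₃m | c₃n = solve (m ∷ n ∷ c₂m ∷ c₂n ∷ c₃m ∷ c₃n ∷ [])

C₂-mono-≤ : ∀ {m n} → m ≤ n → C₂ m ≤ C₂ n
C₂-mono-≤ z≤n       = z≤n
C₂-mono-≤ (s≤s m≤n) = +-mono-≤ (C₂-mono-≤ m≤n) m≤n

C₃-mono-≤ : ∀ {m n} → m ≤ n → C₃ m ≤ C₃ n
C₃-mono-≤ z≤n       = z≤n
C₃-mono-≤ (s≤s m≤n) = +-mono-≤ (C₃-mono-≤ m≤n) (C₂-mono-≤ m≤n)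

-- Stars in complete tripartite graphs

tripartiteStars : ℕ → ℕ → ℕ → ℕ
tripartiteStars p q r = p * C₃ (q + r) + q * C₃ (p + r) + r * C₃ (p + q)

-- C₃-exchange with y = z + a and x = z + b.  Expanding every binomial of a sum
-- by C₂-+ and C₃-+ turns it into a polynomial identity in z, a, b and their
-- binomials, whose surplus on the right has nonnegative coefficients.
C₃-exchange-identity : ∀ z a b →
  (z + b) * C₂ ((z + a) + z) + C₃ ((z + b) + (z + a)) ≡
  C₃ ((z + a) + z) + z * C₂ ((z + b) + (z + a)) +
  (C₃ b + (a + z) * C₂ b + b * (2 * C₂ a + 3 * z * a + 4 * C₂ z))
C₃-exchange-identity z a b
  rewrite C₃-+ (z + a) z | C₃-+ (z + b) (z + a) | C₂-+ (z + a) z | C₂-+ (z + b) (z + a)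
        | C₃-+ z a | C₃-+ z b | C₂-+ z a | C₂-+ z b
  with C₂ z | C₂ a | C₂ b | C₃ z | C₃ a | C₃ b
... | c₂z | c₂a | c₂b | c₃z | c₃a | c₃b =
  solve (z ∷ a ∷ b ∷ c₂z ∷ c₂a ∷ c₂b ∷ c₃z ∷ c₃a ∷ c₃b ∷ [])

C₃-exchange : ∀ {x y z} → z ≤ y → z ≤ x →
  C₃ (y + z) + z * C₂ (x + y) ≤ x * C₂ (y + z) + C₃ (x + y)
C₃-exchange {z = z} z≤y z≤x
  with a , refl ← m≤n⇒∃[o]m+o≡n z≤y | b , refl ← m≤n⇒∃[o]m+o≡n z≤x =
  ≤-trans (m≤m+n _ _) (≤-reflexive (sym (C₃-exchange-identity z a b)))

tripartiteStars-suc₁ : ∀ x y z → tripartiteStars (suc x) y z ≡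
  (x * C₃ (y + z) + y * C₃ (x + suc z) + z * C₃ (x + y)) + (C₃ (y + z) + z * C₂ (x + y))
tripartiteStars-suc₁ x y z rewrite +-suc x z
  with C₃ (y + z) | C₃ (suc (x + z)) | C₃ (x + y) | C₂ (x + y)
... | a | b | c | d = solve (x ∷ y ∷ z ∷ a ∷ b ∷ c ∷ d ∷ [])

tripartiteStars-suc₃ : ∀ x y z → tripartiteStars x y (suc z) ≡
  (x * C₃ (y + z) + y * C₃ (x + suc z) + z * C₃ (x + y)) + (x * C₂ (y + z) + C₃ (x + y))
tripartiteStars-suc₃ x y z rewrite +-suc y z
  with C₃ (y + z) | C₂ (y + z) | C₃ (x + suc z) | C₃ (x + y)
... | a | b | c | d = solve (x ∷ y ∷ z ∷ a ∷ b ∷ c ∷ d ∷ [])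

tripartiteStars-shift : ∀ {x y z} → z ≤ y → z ≤ x →
  tripartiteStars (suc x) y z ≤ tripartiteStars x y (suc z)
tripartiteStars-shift {x} {y} {z} z≤y z≤x = begin
  tripartiteStars (suc x) y z             ≡⟨ tripartiteStars-suc₁ x y z ⟩
  common + (C₃ (y + z) + z * C₂ (x + y))  ≤⟨ +-monoʳ-≤ common (C₃-exchange z≤y z≤x) ⟩
  common + (x * C₂ (y + z) + C₃ (x + y))  ≡⟨ tripartiteStars-suc₃ x y z ⟨
  tripartiteStars x y (suc z)             ∎
  where
  open ≤-Reasoning
  common = x * C₃ (y + z) + y * C₃ (x + suc z) + z * C₃ (x + y)

record Symmetric₃ (f : ℕ → ℕ → ℕ → ℕ) : Set where
  field
    swap₁₂ : ∀ p q r → f p q r ≡ f q p r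
    swap₂₃ : ∀ p q r → f p q r ≡ f p r q

open Symmetric₃

Rearrangement : ℕ → ℕ → ℕ → ℕ → ℕ → ℕ → Set
Rearrangement p q r x y z = ∀ {f} → Symmetric₃ f → f p q r ≡ f x y z

Descending : ℕ → ℕ → ℕ → Set
Descending x y z = y ≤ x × z ≤ y

insert₃ : ∀ {p q} → q ≤ p → ∀ r →
  ∃[ x ] ∃[ y ] ∃[ z ] Descending x y z × Rearrangement p q r x y z
insert₃ {p} {q} q≤p r with ≤-total r q | ≤-total r p
... | inj₁ r≤q | _        = p , q , r , (q≤p , r≤q) , λ _ → refl
... | inj₂ q≤r | inj₁ r≤p = p , r , q , (r≤p , q≤r) , λ s → swap₂₃ s p q r
... | inj₂ q≤r | inj₂ p≤r =
  r , p , q , (p≤r , q≤p) , λ s → trans (swap₂₃ s p q r) (swap₁₂ s p r q)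

sort₃ : ∀ p q r → ∃[ x ] ∃[ y ] ∃[ z ] Descending x y z × Rearrangement p q r x y z
sort₃ p q r with ≤-total q p
... | inj₁ q≤p = insert₃ q≤p r
... | inj₂ p≤q with x , y , z , desc , same ← insert₃ p≤q r =
  x , y , z , desc , λ s → trans (swap₁₂ s p q r) (same s)

sum₃ sumSq : ℕ → ℕ → ℕ → ℕ
sum₃ x y z = x + y + z
sumSq x y z = x * x + y * y + z * z

sum₃-symmetric : Symmetric₃ sum₃
sum₃-symmetric = record { swap₁₂ = swap₁₂′ ; swap₂₃ = swap₂₃′ }
  where
  swap₁₂′ : ∀ p q r → p + q + r ≡ q + p + r
  swap₁₂′ = solve-∀
  swap₂₃′ : ∀ p q r → p + q + r ≡ p + r + q
  swap₂₃′ = solve-∀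

sumSq-symmetric : Symmetric₃ sumSq
sumSq-symmetric = record { swap₁₂ = swap₁₂′ ; swap₂₃ = swap₂₃′ }
  where
  swap₁₂′ : ∀ p q r → p * p + q * q + r * r ≡ q * q + p * p + r * r
  swap₁₂′ = solve-∀
  swap₂₃′ : ∀ p q r → p * p + q * q + r * r ≡ p * p + r * r + q * q
  swap₂₃′ = solve-∀

tripartiteStars-symmetric : Symmetric₃ tripartiteStars
tripartiteStars-symmetric = record { swap₁₂ = swap₁₂′ ; swap₂₃ = swap₂₃′ }
  where
  swap₁₂′ : ∀ p q r → tripartiteStars p q r ≡ tripartiteStars q p r
  swap₁₂′ p q r rewrite +-comm p q with C₃ (q + r) | C₃ (p + r) | C₃ (q + p)
  ... | a | b | c = solve (p ∷ q ∷ r ∷ a ∷ b ∷ c ∷ [])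
  swap₂₃′ : ∀ p q r → tripartiteStars p q r ≡ tripartiteStars p r q
  swap₂₃′ p q r rewrite +-comm q r with C₃ (r + q) | C₃ (p + r) | C₃ (p + q)
  ... | a | b | c = solve (p ∷ q ∷ r ∷ a ∷ b ∷ c ∷ [])

balance : ℕ → ℕ × ℕ × ℕ
balance 0                   = 0 , 0 , 0
balance 1                   = 1 , 0 , 0
balance 2                   = 1 , 1 , 0
balance (suc (suc (suc n))) = let x , y , z = balance n in suc x , suc y , suc z

sum₃-suc : ∀ x y z → suc x + suc y + suc z ≡ 3 + (x + y + z)
sum₃-suc = solve-∀

balance-descending : ∀ {x y z} → Descending x y z → x ≤ suc z → balance (sum₃ x y z) ≡ (x , y , z)
balance-descending {z = zero} (z≤n     , z≤n) z≤n       = refl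
balance-descending {z = zero} (z≤n     , z≤n) (s≤s z≤n) = refl
balance-descending {z = zero} (s≤s z≤n , z≤n) (s≤s z≤n) = refl
balance-descending {suc x} {suc y} {suc z} (s≤s y≤x , s≤s z≤y) (s≤s x≤1+z)
  rewrite sum₃-suc x y z | balance-descending (y≤x , z≤y) x≤1+z = refl

sumSq-shift : ∀ {x y z} → z < x → sumSq x y (suc z) < sumSq (suc x) y z
sumSq-shift {y = y} {z} z<x with k , refl ← m≤n⇒∃[o]m+o≡n z<x =
  subst (sumSq (suc z + k) y (suc z) <_) (sym (identity z k y)) (m<m+n _ (s≤s z≤n))
  where
  identity : ∀ z k y → let x = suc z + k in
    suc x * suc x + y * y + z * z ≡ x * x + y * y + suc z * suc z + 2 * suc k
  identity = solve-∀

module _ {a b c : ℕ} where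

  private
    BoundedByBalanced : ℕ → ℕ → ℕ → Set
    BoundedByBalanced p q r =
      balance (sum₃ p q r) ≡ (a , b , c) → tripartiteStars p q r ≤ tripartiteStars a b c

  -- Induction on the sum of squares, which every shift strictly decreases.
  mutual
    private
      ≤-balanced-descending : ∀ {x y z m} → Descending x y z → Acc _<_ m → sumSq x y z ≡ m →
        BoundedByBalanced x y z
      ≤-balanced-descending {x} {y} {z} desc@(_ , z≤y) (acc rs) refl eq with x ≤? suc z
      ... | yes x≤1+z = ≤-reflexive (cong (λ (p , q , r) → tripartiteStars p q r)
                          (trans (sym (balance-descending desc x≤1+z)) eq))
      ... | no x≰1+z with ≰⇒> x≰1+z
      ...   | s≤s {n = x′} z<x′ =
        ≤-trans (tripartiteStars-shift z≤y (<⇒≤ z<x′))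
                (≤-balanced {x′} {y} {suc z} (rs (sumSq-shift {y = y} z<x′)) refl
                  (trans (cong balance (+-suc (x′ + y) z)) eq))

      ≤-balanced : ∀ {p q r m} → Acc _<_ m → sumSq p q r ≡ m → BoundedByBalanced p q r
      ≤-balanced {p} {q} {r} ac sq≡m eq with x , y , z , desc , same ← sort₃ p q r =
        subst (_≤ tripartiteStars a b c) (sym (same tripartiteStars-symmetric))
          (≤-balanced-descending desc ac (trans (sym (same sumSq-symmetric)) sq≡m)
            (trans (cong balance (sym (same sum₃-symmetric))) eq))

  tripartiteStars-≤-balanced : ∀ p q r →
    balance (sum₃ p q r) ≡ (a , b , c) → tripartiteStars p q r ≤ tripartiteStars a b c
  tripartiteStars-≤-balanced p q r = ≤-balanced {p} {q} {r} (<-wellFounded _) refl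

𝟙 : Bool → ℕ
𝟙 b = if b then 1 else 0

count : ∀ {n} → (Fin n → Bool) → ℕ
count {n} P = ∑[ i < n ] 𝟙 (P i)

∑-1 : ∀ n → ∑[ i < n ] 1 ≡ n
∑-1 zero    = refl
∑-1 (suc n) = cong suc (∑-1 n)

∑-mono-≤ : ∀ {n} {f g : Fin n → ℕ} → (∀ i → f i ≤ g i) → ∑[ i < n ] f i ≤ ∑[ i < n ] g i
∑-mono-≤ {zero}  f≤g = z≤n
∑-mono-≤ {suc n} f≤g = +-mono-≤ (f≤g zero) (∑-mono-≤ (f≤g ∘ suc))

𝟙-mono : ∀ {x y} → (T x → T y) → 𝟙 x ≤ 𝟙 y
𝟙-mono {false}         _   = z≤n
𝟙-mono {true}  {true}  _   = ≤-refl
𝟙-mono {true}  {false} x⇒y = ⊥-elim (x⇒y tt)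

count-mono : ∀ {n} {P Q : Fin n → Bool} → (∀ i → T (P i) → T (Q i)) → count P ≤ count Q
count-mono P⇒Q = ∑-mono-≤ (λ i → 𝟙-mono (P⇒Q i))

𝟙-split : ∀ x y → 𝟙 x ≡ 𝟙 (x ∧ y) + 𝟙 (x ∧ not y)
𝟙-split true  true  = refl
𝟙-split true  false = refl
𝟙-split false y     = refl

count-split : ∀ {n} (P Q : Fin n → Bool) →
  count P ≡ count (λ i → P i ∧ Q i) + count (λ i → P i ∧ not (Q i))
count-split {n} P Q = trans (sum-cong-≗ {n} λ i → 𝟙-split (P i) (Q i)) (∑-distrib-+ {n} _ _)

∑-𝟙-∧ : ∀ {n} x (P : Fin n → Bool) → ∑[ i < n ] 𝟙 (x ∧ P i) ≡ 𝟙 x * count P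
∑-𝟙-∧     true  P = sym (+-identityʳ _)
∑-𝟙-∧ {n} false P = sum-replicate-zero n

sum-map-tabulate : ∀ {A : Set} {n} (f : Fin n → A) (h : A → ℕ) →
  List.sum (map h (tabulate f)) ≡ ∑[ i < n ] h (f i)
sum-map-tabulate {n = zero}  f h = refl
sum-map-tabulate {n = suc n} f h = cong (h (f zero) +_) (sum-map-tabulate (f ∘ suc) h)

sum-concatMap-tabulate : ∀ {A : Set} {n} (f : Fin n → A) (g : A → List ℕ) →
  List.sum (concatMap g (tabulate f)) ≡ ∑[ i < n ] List.sum (g (f i))
sum-concatMap-tabulate {n = zero}  f g = refl
sum-concatMap-tabulate {n = suc n} f g =
  trans (sum-++ (g (f zero)) _) (cong (List.sum (g (f zero)) +_) (sum-concatMap-tabulate (f ∘ suc) g))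

-- Both sides unfold to ⌊ map′ _ _ d ⌋ for the same decision d of toℕ i < toℕ j.
<ᵇ-suc : ∀ {n} (i j : Fin n) → (suc i <ᵇ suc j) ≡ (i <ᵇ j)
<ᵇ-suc i j = trans (⌊⌋-map′ _ _ _) (sym (⌊⌋-map′ _ _ _))

∧-swap : ∀ x y z → x ∧ (y ∧ z) ≡ y ∧ (x ∧ z)
∧-swap false y z = sym (∧-zeroʳ y)
∧-swap true  y z = refl

C₂-𝟙+ : ∀ x m → 𝟙 x * m + C₂ m ≡ C₂ (𝟙 x + m)
C₂-𝟙+ true  m = trans (cong (_+ C₂ m) (+-identityʳ m)) (+-comm m (C₂ m))
C₂-𝟙+ false m = refl

C₃-𝟙+ : ∀ x m → 𝟙 x * C₂ m + C₃ m ≡ C₃ (𝟙 x + m)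
C₃-𝟙+ true  m = trans (cong (_+ C₃ m) (+-identityʳ (C₂ m))) (+-comm (C₂ m) (C₃ m))
C₃-𝟙+ false m = refl

ascendingPairs : ∀ {n} → (Fin n → Bool) → ℕ
ascendingPairs {n} P = ∑[ b < n ] ∑[ d < n ] 𝟙 ((b <ᵇ d) ∧ P b ∧ P d)

ascendingTriples : ∀ {n} → (Fin n → Bool) → ℕ
ascendingTriples {n} P =
  ∑[ a < n ] ∑[ b < n ] ∑[ d < n ] 𝟙 ((a <ᵇ b) ∧ (b <ᵇ d) ∧ P a ∧ P b ∧ P d)

ascendingPairs≡C₂ : ∀ {n} (P : Fin n → Bool) → ascendingPairs P ≡ C₂ (count P)
ascendingPairs≡C₂ {zero}  P = refl
ascendingPairs≡C₂ {suc n} P = begin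
  ∑[ d < n ] 𝟙 (P zero ∧ Q d) + ∑[ b < n ] ∑[ d < n ] 𝟙 ((suc b <ᵇ suc d) ∧ Q b ∧ Q d)
    ≡⟨ cong₂ _+_ (∑-𝟙-∧ (P zero) Q)
                 (sum-cong-≗ λ b → sum-cong-≗ λ d → cong (λ t → 𝟙 (t ∧ Q b ∧ Q d)) (<ᵇ-suc b d)) ⟩
  𝟙 (P zero) * count Q + ascendingPairs Q
    ≡⟨ cong (𝟙 (P zero) * count Q +_) (ascendingPairs≡C₂ Q) ⟩
  𝟙 (P zero) * count Q + C₂ (count Q)
    ≡⟨ C₂-𝟙+ (P zero) (count Q) ⟩
  C₂ (count P) ∎
  where
  open ≡-Reasoning
  Q = P ∘ suc

ascendingTriples≡C₃ : ∀ {n} (P : Fin n → Bool) → ascendingTriples P ≡ C₃ (count P)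
ascendingTriples≡C₃ {zero}  P = refl
ascendingTriples≡C₃ {suc n} P = begin
  ascendingTriples P
    ≡⟨ cong₂ _+_ firstRow laterRows ⟩
  𝟙 (P zero) * ascendingPairs Q + ascendingTriples Q
    ≡⟨ cong₂ (λ s t → 𝟙 (P zero) * s + t) (ascendingPairs≡C₂ Q) (ascendingTriples≡C₃ Q) ⟩
  𝟙 (P zero) * C₂ (count Q) + C₃ (count Q)
    ≡⟨ C₃-𝟙+ (P zero) (count Q) ⟩
  C₃ (count P) ∎
  where
  open ≡-Reasoning
  Q = P ∘ suc

  firstRow : ∑[ b < suc n ] ∑[ d < suc n ] 𝟙 ((zero <ᵇ b) ∧ (b <ᵇ d) ∧ P zero ∧ P b ∧ P d)
           ≡ 𝟙 (P zero) * ascendingPairs Q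
  firstRow = begin
    ∑[ d < suc n ] 0 + ∑[ b < n ] ∑[ d < n ] 𝟙 ((suc b <ᵇ suc d) ∧ P zero ∧ Q b ∧ Q d)
      ≡⟨ cong₂ _+_ (sum-replicate-zero (suc n)) (sum-cong-≗ {n} λ b → sum-cong-≗ {n} λ d →
           cong 𝟙 (trans (cong (_∧ P zero ∧ Q b ∧ Q d) (<ᵇ-suc b d)) (∧-swap (b <ᵇ d) (P zero) _))) ⟩
    ∑[ b < n ] ∑[ d < n ] 𝟙 (P zero ∧ (b <ᵇ d) ∧ Q b ∧ Q d)
      ≡⟨ sum-cong-≗ {n} (λ b → ∑-𝟙-∧ {n} (P zero) _) ⟩
    ∑[ b < n ] (𝟙 (P zero) * ∑[ d < n ] 𝟙 ((b <ᵇ d) ∧ Q b ∧ Q d))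
      ≡⟨ *-distribˡ-sum {n} (𝟙 (P zero)) _ ⟨
    𝟙 (P zero) * ascendingPairs Q ∎

  laterRows :
    ∑[ a < n ] ∑[ b < suc n ] ∑[ d < suc n ] 𝟙 ((suc a <ᵇ b) ∧ (b <ᵇ d) ∧ Q a ∧ P b ∧ P d)
    ≡ ascendingTriples Q
  laterRows = sum-cong-≗ λ a → cong₂ _+_ (sum-replicate-zero (suc n)) (sum-cong-≗ λ b →
    cong₂ _+_ (cong 𝟙 (∧-zeroʳ (suc a <ᵇ suc b))) (sum-cong-≗ λ d →
      cong 𝟙 (cong₂ (λ s t → s ∧ t ∧ Q a ∧ Q b ∧ Q d) (<ᵇ-suc a b) (<ᵇ-suc b d))))

-- Copies of S₄ and degrees

degree : ∀ {n} → SimpleGraph n → Fin n → ℕ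
degree G v = count (adj G v)

adjacent⇒≢ᵇ : ∀ {n} (G : SimpleGraph n) u v → T (adj G u v) → T (u ≢ᵇ v)
adjacent⇒≢ᵇ G u v uv with u Fin.≟ v
... | yes refl = ⊥-elim (subst T (loopless G u) uv)
... | no _     = tt

∧-implied : ∀ {x} y → (T y → T x) → x ∧ y ≡ y
∧-implied {true}  y     y⇒x = refl
∧-implied {false} false y⇒x = refl
∧-implied {false} true  y⇒x = ⊥-elim (y⇒x tt)

isS4copy≡ : ∀ {n} (G : SimpleGraph n) c a b d →
  isS4copy G c a b d ≡ (a <ᵇ b) ∧ (b <ᵇ d) ∧ adj G c a ∧ adj G c b ∧ adj G c d
isS4copy≡ G c a b d = cong (λ t → (a <ᵇ b) ∧ (b <ᵇ d) ∧ t) (begin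
  (c ≢ᵇ a) ∧ (c ≢ᵇ b) ∧ (c ≢ᵇ d) ∧ edges
    ≡⟨ cong (λ t → (c ≢ᵇ a) ∧ (c ≢ᵇ b) ∧ t) (∧-implied edges (adjacent⇒≢ᵇ G c d ∘ edge₃)) ⟩
  (c ≢ᵇ a) ∧ (c ≢ᵇ b) ∧ edges
    ≡⟨ cong ((c ≢ᵇ a) ∧_) (∧-implied edges (adjacent⇒≢ᵇ G c b ∘ edge₂)) ⟩
  (c ≢ᵇ a) ∧ edges
    ≡⟨ ∧-implied edges (adjacent⇒≢ᵇ G c a ∘ edge₁) ⟩
  edges ∎)
  where
  open ≡-Reasoning
  edges = adj G c a ∧ adj G c b ∧ adj G c d
  split : ∀ {x y} → T (x ∧ y) → T x × T y
  split = Equivalence.to T-∧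
  edge₁ : T edges → T (adj G c a)
  edge₁ e = proj₁ (split {adj G c a} e)
  edge₂ : T edges → T (adj G c b)
  edge₂ e = proj₁ (split {adj G c b} (proj₂ (split {adj G c a} e)))
  edge₃ : T edges → T (adj G c d)
  edge₃ e = proj₂ (split {adj G c b} (proj₂ (split {adj G c a} e)))

numS4≡∑C₃degree : ∀ {n} (G : SimpleGraph n) → numS4 G ≡ ∑[ c < n ] C₃ (degree G c)
numS4≡∑C₃degree {n} G =
  trans (sum-concatMap-tabulate {n = n} id _) (sum-cong-≗ {n} λ c → trans
    (trans (sum-concatMap-tabulate {n = n} id _) (sum-cong-≗ {n} λ a →
     trans (sum-concatMap-tabulate {n = n} id _) (sum-cong-≗ {n} λ b →
     trans (sum-map-tabulate {n = n} id _) (sum-cong-≗ {n} λ d → cong 𝟙 (isS4copy≡ G c a b d)))))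
    (ascendingTriples≡C₃ (adj G c)))

∑₃ : (ℕ → ℕ) → ℕ
∑₃ f = f 0 + f 1 + f 2

decompose₃ : ∀ {c} → c < 3 → (F : ℕ → ℕ) → F c ≡ ∑₃ (λ k → 𝟙 (c ≡ᵇ k) * F k)
decompose₃ {0} _ F with F 0 | F 1 | F 2
... | a | b | c = solve (a ∷ b ∷ c ∷ [])
decompose₃ {1} _ F with F 0 | F 1 | F 2
... | a | b | c = solve (a ∷ b ∷ c ∷ [])
decompose₃ {2} _ F with F 0 | F 1 | F 2
... | a | b | c = solve (a ∷ b ∷ c ∷ [])
decompose₃ {suc (suc (suc _))} (s≤s (s≤s (s≤s ()))) F

module _ {n} (col : Fin n → ℕ) where

  classSize : ℕ → ℕ
  classSize k = count (λ v → col v ≡ᵇ k)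

  multipartiteDegree : Fin n → ℕ
  multipartiteDegree v = count (λ w → not (col v ≡ᵇ col w))

  module _ (col<3 : ∀ v → col v < 3) where

    ∑-decompose₃ : (F : ℕ → ℕ) → ∑[ v < n ] F (col v) ≡ ∑₃ (λ k → classSize k * F k)
    ∑-decompose₃ F = begin
      ∑[ v < n ] F (col v)
        ≡⟨ sum-cong-≗ {n} (λ v → decompose₃ (col<3 v) F) ⟩
      ∑[ v < n ] (part 0 v + part 1 v + part 2 v)
        ≡⟨ ∑-distrib-+ (λ v → part 0 v + part 1 v) (part 2) ⟩
      ∑[ v < n ] (part 0 v + part 1 v) + ∑[ v < n ] part 2 v
        ≡⟨ cong (_+ ∑[ v < n ] part 2 v) (∑-distrib-+ (part 0) (part 1)) ⟩
      ∑[ v < n ] part 0 v + ∑[ v < n ] part 1 v + ∑[ v < n ] part 2 v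
        ≡⟨ cong₂ _+_ (cong₂ _+_ (classTerm 0) (classTerm 1)) (classTerm 2) ⟩
      ∑₃ (λ k → classSize k * F k) ∎
      where
      open ≡-Reasoning
      part : ℕ → Fin n → ℕ
      part k v = 𝟙 (col v ≡ᵇ k) * F k
      classTerm : ∀ k → ∑[ v < n ] part k v ≡ classSize k * F k
      classTerm k = sym (*-distribʳ-sum {n} (F k) _)

    ∑C₃-multipartiteDegree :
      ∑[ v < n ] C₃ (multipartiteDegree v) ≡ tripartiteStars (classSize 0) (classSize 1) (classSize 2)
    ∑C₃-multipartiteDegree = begin
      ∑[ v < n ] C₃ (multipartiteDegree v)
        ≡⟨ sum-cong-≗ {n} (λ v → cong C₃ (∑-decompose₃ (λ c → 𝟙 (not (col v ≡ᵇ c))))) ⟩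
      ∑[ v < n ] C₃ (outside (col v))
        ≡⟨ ∑-decompose₃ (C₃ ∘ outside) ⟩
      ∑₃ (λ k → classSize k * C₃ (outside k))
        ≡⟨ cong₂ _+_ (cong₂ _+_ (cong (λ t → s₀ * C₃ t) (e₀ s₀ s₁ s₂))
                                (cong (λ t → s₁ * C₃ t) (e₁ s₀ s₁ s₂)))
                     (cong (λ t → s₂ * C₃ t) (e₂ s₀ s₁ s₂)) ⟩
      tripartiteStars s₀ s₁ s₂ ∎
      where
      open ≡-Reasoning
      s₀ = classSize 0
      s₁ = classSize 1
      s₂ = classSize 2
      outside : ℕ → ℕ
      outside c = ∑₃ (λ k → classSize k * 𝟙 (not (c ≡ᵇ k)))
      e₀ : ∀ a b c → a * 0 + b * 1 + c * 1 ≡ b + c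
      e₀ = solve-∀
      e₁ : ∀ a b c → a * 1 + b * 0 + c * 1 ≡ a + c
      e₁ = solve-∀
      e₂ : ∀ a b c → a * 1 + b * 1 + c * 0 ≡ a + b
      e₂ = solve-∀

    classSizes-sum : classSize 0 + classSize 1 + classSize 2 ≡ n
    classSizes-sum = begin
      classSize 0 + classSize 1 + classSize 2  ≡⟨ e (classSize 0) (classSize 1) (classSize 2) ⟩
      ∑₃ (λ k → classSize k * 1)                ≡⟨ ∑-decompose₃ (λ _ → 1) ⟨
      ∑[ v < n ] 1                              ≡⟨ ∑-1 n ⟩
      n                                         ∎
      where
      open ≡-Reasoning
      e : ∀ a b c → a + b + c ≡ a * 1 + b * 1 + c * 1
      e = solve-∀

    proper⇒K4-free : (G : SimpleGraph n) → (∀ u v → u ~[ G ] v → col u ≢ col v) → K4-free G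
    proper⇒K4-free G proper (a , b , c , d , ab , ac , ad , bc , bd , cd) =
      repeatedColour (pigeonhole (n<1+n 3) colour)
      where
      vertex : Fin 4 → Fin n
      vertex = Vec.lookup (a Vec.∷ b Vec.∷ c Vec.∷ d Vec.∷ Vec.[])
      colour : Fin 4 → Fin 3
      colour i = fromℕ< (col<3 (vertex i))
      edge : ∀ {i j} → i Fin.< j → vertex i ~[ G ] vertex j
      edge {zero}              {suc zero}             _ = ab
      edge {zero}              {suc (suc zero)}       _ = ac
      edge {zero}              {suc (suc (suc zero))} _ = ad
      edge {suc zero}          {suc (suc zero)}       _ = bc
      edge {suc zero}          {suc (suc (suc zero))} _ = bd
      edge {suc (suc zero)}    {suc (suc (suc zero))} _ = cd
      edge {_}                 {zero}                 ()
      edge {suc _}             {suc zero}             (s≤s ())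
      edge {suc (suc _)}       {suc (suc zero)}       (s≤s (s≤s ()))
      edge {suc (suc (suc _))} {suc (suc (suc zero))} (s≤s (s≤s (s≤s ())))
      repeatedColour : (∃₂ λ i j → i Fin.< j × colour i ≡ colour j) → ⊥
      repeatedColour (i , j , i<j , same) = proper (vertex i) (vertex j) (edge i<j)
        (trans (sym (toℕ-fromℕ< _)) (trans (cong toℕ same) (toℕ-fromℕ< _)))

-- Erdős' degree majorisation

maximum-attained : ∀ {m} (f : Fin (suc m) → ℕ) → ∃ λ x → ∀ v → f v ≤ f x
maximum-attained f =
  argmax f zero (allFin _) , λ v → All.lookup (f[xs]≤f[argmax] {f = f} zero (allFin _)) (∈-allFin v)

T-∧ʳ : ∀ x {y} → T (x ∧ y) → T y
T-∧ʳ true xy = xy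

T-≡true : ∀ {x} → x ≡ true → T x
T-≡true = Equivalence.from T-≡

colourOf : Bool → Bool → ℕ
colourOf a b = if a then (if b then 2 else 1) else 0

colourOf<3 : ∀ a b → colourOf a b < 3
colourOf<3 true  true  = s≤s (s≤s (s≤s z≤n))
colourOf<3 true  false = s≤s (s≤s z≤n)
colourOf<3 false b     = s≤s z≤n

colourOf≢0 : ∀ a b → not (0 ≡ᵇ colourOf a b) ≡ a
colourOf≢0 true  true  = refl
colourOf≢0 true  false = refl
colourOf≢0 false b     = refl

colourOf≢1-∧ : ∀ a b → (not (1 ≡ᵇ colourOf a b) ∧ a) ≡ (b ∧ a)
colourOf≢1-∧ true  true  = refl
colourOf≢1-∧ true  false = refl
colourOf≢1-∧ false b     = sym (∧-zeroʳ b)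

colourOf≢1-∧-not : ∀ a b → (not (1 ≡ᵇ colourOf a b) ∧ not a) ≡ not a
colourOf≢1-∧-not true  b = ∧-zeroʳ _
colourOf≢1-∧-not false b = refl

module Majorisation {n} (G : SimpleGraph n) (K4-free-G : K4-free G)
                    (x : Fin n) (x-max : ∀ v → degree G v ≤ degree G x) where

  A : Fin n → Bool
  A = adj G x

  degreeInA : Fin n → ℕ
  degreeInA u = count (λ w → adj G u w ∧ A w)

  -- The `suc` makes every vertex of A outscore every vertex outside A, so a
  -- maximiser lies in A as soon as A is nonempty.
  score : Fin n → ℕ
  score u = if A u then suc (degreeInA u) else 0

  score-A : ∀ {v} → A v ≡ true → score v ≡ suc (degreeInA v)
  score-A v∈A rewrite v∈A = refl

  module Colouring (y : Fin n) (y-max : ∀ v → score v ≤ score y) where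

    colour : Fin n → ℕ
    colour v = colourOf (A v) (adj G y v)

    y∈A : ∀ {v} → A v ≡ true → A y ≡ true
    y∈A {v} v∈A with A y
    ... | true  = refl
    ... | false = ⊥-elim (n≮0 (subst (_≤ 0) (score-A v∈A) (y-max v)))

    degreeInA-max : ∀ {v} → A v ≡ true → degreeInA v ≤ degreeInA y
    degreeInA-max {v} v∈A = s≤s⁻¹ (subst₂ _≤_ (score-A v∈A) (score-A (y∈A v∈A)) (y-max v))

    degree≤-outside-A : ∀ {v} → A v ≡ false → degree G v ≤ count (λ w → not (0 ≡ᵇ colour w))
    degree≤-outside-A {v} _ = subst (degree G v ≤_)
      (sum-cong-≗ {n} λ w → cong 𝟙 (sym (colourOf≢0 (A w) (adj G y w)))) (x-max v)

    degree≤-A∖N[y] : ∀ {v} → A v ≡ true → degree G v ≤ count (λ w → not (1 ≡ᵇ colour w))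
    degree≤-A∖N[y] {v} v∈A = begin
      degree G v
        ≡⟨ count-split (adj G v) A ⟩
      degreeInA v + count (λ w → adj G v w ∧ not (A w))
        ≤⟨ +-mono-≤ (degreeInA-max v∈A) (count-mono λ w → T-∧ʳ (adj G v w)) ⟩
      degreeInA y + count (λ w → not (A w))
        ≡⟨ cong₂ _+_ (sum-cong-≗ {n} λ w → cong 𝟙 (sym (colourOf≢1-∧ (A w) (adj G y w))))
                     (sum-cong-≗ {n} λ w → cong 𝟙 (sym (colourOf≢1-∧-not (A w) (adj G y w)))) ⟩
      count (λ w → R w ∧ A w) + count (λ w → R w ∧ not (A w))
        ≡⟨ count-split R A ⟨
      count R ∎
      where
      open ≤-Reasoning
      R : Fin n → Bool
      R w = not (1 ≡ᵇ colour w)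

    degree≤-A∩N[y] : ∀ {v} → A v ≡ true → adj G y v ≡ true →
      degree G v ≤ count (λ w → not (2 ≡ᵇ colour w))
    degree≤-A∩N[y] {v} v∈A yv = count-mono notColour2
      where
      notColour2 : ∀ w → T (adj G v w) → T (not (2 ≡ᵇ colourOf (A w) (adj G y w)))
      notColour2 w vw with A w in w∈A | adj G y w in yw
      ... | false | _     = tt
      ... | true  | false = tt
      ... | true  | true  = ⊥-elim (K4-free-G (x , y , v , w ,
        T-≡true (y∈A v∈A) , T-≡true v∈A , T-≡true w∈A , T-≡true yv , T-≡true yw , vw))

    degree≤multipartiteDegree : ∀ v → degree G v ≤ multipartiteDegree colour v
    degree≤multipartiteDegree v with A v in v∈A | adj G y v in yv
    ... | false | _     = degree≤-outside-A v∈A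
    ... | true  | false = degree≤-A∖N[y] v∈A
    ... | true  | true  = degree≤-A∩N[y] v∈A yv

degree-majorisation : ∀ {n} (G : SimpleGraph n) → K4-free G →
  ∃ λ (col : Fin n → ℕ) → (∀ v → col v < 3) × (∀ v → degree G v ≤ multipartiteDegree col v)
degree-majorisation {zero}  G _  = (λ ()) , (λ ()) , (λ ())
degree-majorisation {suc m} G k4 =
  colour , (λ v → colourOf<3 (A v) (adj G y v)) , degree≤multipartiteDegree
  where
  x = proj₁ (maximum-attained (degree G))
  open Majorisation G k4 x (proj₂ (maximum-attained (degree G)))
  y = proj₁ (maximum-attained score)
  open Colouring y (proj₂ (maximum-attained score))

-- The Turán graph T₃(n)

T3-colour : ∀ {n} → Fin n → ℕ
T3-colour v = toℕ v % 3

T3-colour<3 : ∀ {n} (v : Fin n) → T3-colour v < 3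
T3-colour<3 v = m%n<n (toℕ v) 3

T3-proper : ∀ {n} (u v : Fin n) → u ~[ T3 n ] v → T3-colour u ≢ T3-colour v
T3-proper u v uv same =
  subst T (Equivalence.to T-not-≡ uv) (≡⇒≡ᵇ (T3-colour u) (T3-colour v) same)

T3-classSize : ℕ → ℕ → ℕ
T3-classSize n = classSize {n} T3-colour

T3-classSizes≡balance : ∀ n → (T3-classSize n 0 , T3-classSize n 1 , T3-classSize n 2) ≡ balance n
T3-classSizes≡balance 0 = refl
T3-classSizes≡balance 1 = refl
T3-classSizes≡balance 2 = refl
T3-classSizes≡balance (suc (suc (suc n))) =
  trans (cong₂ _,_ (cong suc (shift 0)) (cong₂ _,_ (cong suc (shift 1)) (cong suc (shift 2))))
        (cong (λ (p , q , r) → suc p , suc q , suc r) (T3-classSizes≡balance n))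
  where
  shift : ∀ k → count {n} (λ j → (3 + toℕ j) % 3 ≡ᵇ k) ≡ T3-classSize n k
  shift k = sum-cong-≗ {n} λ j →
    cong (λ t → 𝟙 (t ≡ᵇ k)) (trans (cong (_% 3) (+-comm 3 (toℕ j))) ([m+n]%n≡m%n (toℕ j) 3))

T3-K4-free : ∀ n → K4-free (T3 n)
T3-K4-free n = proper⇒K4-free {n} T3-colour T3-colour<3 (T3 n) T3-proper

numS4-T3 : ∀ n → numS4 (T3 n) ≡ tripartiteStars (T3-classSize n 0) (T3-classSize n 1) (T3-classSize n 2)
numS4-T3 n = trans (numS4≡∑C₃degree (T3 n)) (∑C₃-multipartiteDegree {n} T3-colour T3-colour<3)

numS4≤numS4-T3 : ∀ {n} (G : SimpleGraph n) → K4-free G → numS4 G ≤ numS4 (T3 n)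
numS4≤numS4-T3 {n} G K4-free-G with col , col<3 , degree≤ ← degree-majorisation G K4-free-G = begin
  numS4 G                                   ≡⟨ numS4≡∑C₃degree G ⟩
  ∑[ v < n ] C₃ (degree G v)                ≤⟨ ∑-mono-≤ (λ v → C₃-mono-≤ (degree≤ v)) ⟩
  ∑[ v < n ] C₃ (multipartiteDegree col v)  ≡⟨ ∑C₃-multipartiteDegree col col<3 ⟩
  tripartiteStars s₀ s₁ s₂                  ≤⟨ tripartiteStars-≤-balanced s₀ s₁ s₂ balanced ⟩
  tripartiteStars t₀ t₁ t₂                  ≡⟨ numS4-T3 n ⟨
  numS4 (T3 n)                              ∎
  where
  open ≤-Reasoning
  s₀ = classSize col 0
  s₁ = classSize col 1
  s₂ = classSize col 2
  t₀ = T3-classSize n 0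
  t₁ = T3-classSize n 1
  t₂ = T3-classSize n 2
  balanced : balance (sum₃ s₀ s₁ s₂) ≡ (t₀ , t₁ , t₂)
  balanced = trans (cong balance (classSizes-sum col col<3)) (sym (T3-classSizes≡balance n))

proposition3p12 : ∃ λ (n₀ : ℕ) → ∀ (n : ℕ) → n ≥ n₀ →
    K4-free (T3 n) × (∀ (G : SimpleGraph n) → K4-free G → numS4 G ≤ numS4 (T3 n))
proposition3p12 = 0 , λ n _ → T3-K4-free n , numS4≤numS4-T3
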